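{- Define $\mathbf{c}=(c_0,c_1,\ldots)$ by $c_0=1$ and $c_{n+1}=c_n+1$ if $(c_n+1)/2$ is not a term of $\mathbf{c}$, $c_{n+1}=c_n+2$ otherwise. For $n\ge0$ let $\gamma_n$ be the $n$th Riordan number, i.e. the number of ordered (plane) rooted trees with $n$ edges in which every non-leaf vertex has at least two children. Then $\gamma_n$ is even if and only if $n=2c_k-1$ for some $k\in\mathbb{N}$.
   Context: $\mathbb{N}$ denotes the nonnegative integers; $\gamma_0=1$ (the one-vertex tree). -}

module Defs where

open import Data.Nat using (ℕ; zero; suc; _+_; _*_; _≤_)
open import Data.Nat.Properties using (_≟_)
open import Data.List using (List; []; _∷_; length)
open import Data.List.Relation.Unary.Any using (any?)
open import Data.Product using (_×_; _,_; proj₁; Σ)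
open import Data.Sum using (_⊎_)
open import Relation.Binary.PropositionalEquality using (_≡_)
open import Relation.Nullary.Decidable using (Dec; yes; no)

-- The sequence c = (c₀, c₁, …):
--   c₀ = 1,
--   c_{n+1} = c_n + 1  if (c_n + 1)/2 is not a term of c,
--   c_{n+1} = c_n + 2  otherwise.
-- "(c_n+1)/2 is a term of c" means: ∃ m, 2 * c_m = c_n + 1.
-- Since c is strictly increasing and (c_n+1)/2 ≤ c_n (c_n ≥ 1), any such m
-- satisfies m ≤ n, so it suffices to search among c₀,…,c_n.
-- cPrefix n = (c_n , [c_n, c_{n-1}, …, c_0]).

cNext : ℕ → List ℕ → ℕ
cNext x l with any? (λ y → (2 * y) ≟ (x + 1)) l
... | yes _ = x + 2
... | no  _ = x + 1

cPrefix : ℕ → ℕ × List ℕ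
cPrefix zero = 1 , 1 ∷ []
cPrefix (suc n) with cPrefix n
... | x , l = cNext x l , cNext x l ∷ l

c : ℕ → ℕ
c n = proj₁ (cPrefix n)

data PTree : Set where
  node : List PTree → PTree

mutual
  edges : PTree → ℕ
  edges (node ts) = edgesF ts

  edgesF : List PTree → ℕ
  edgesF []       = 0
  edgesF (t ∷ ts) = suc (edges t) + edgesF ts

mutual
  data Valid : PTree → Set where
    node : ∀ {ts} → (ts ≡ [] ⊎ 2 ≤ length ts) → ValidF ts → Valid (node ts)

  data ValidF : List PTree → Set where
    []  : ValidF []
    _∷_ : ∀ {t ts} → Valid t → ValidF ts → ValidF (t ∷ ts)

RiordanTrees : ℕ → Set
RiordanTrees n = Σ PTree (λ t → edges t ≡ n × Valid t)

-- Removing the root edge of a forest consisting of one tree, and hanging a forest of at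
-- least two trees below a new root, show that forests with m + 1 edges are counted by
-- γ (m + 1) + γ m.  Splitting off the first tree shows that they are also counted by
-- Σ_{i+j=m} γ_i (γ_j + γ_{j-1}), with γ_{-1} = 0.  Modulo 2 the terms γ_i γ_j and
-- γ_j γ_i of the symmetric part cancel, leaving γ_{m/2} for even m and 0 for odd m;
-- this gives γ_{2k} odd and γ_{2k+1} ≡ γ_k + 1 (mod 2).  So γ_n is even iff n = 2y - 1
-- where γ_{y-1} is odd, and the set of these y contains every odd number and contains an
-- even number 2j iff it does not contain j.  The rule defining c is precisely the
-- increasing enumeration of such a set.

module Submission where

open import Defs
open import Data.Nat using (ℕ; zero; suc; _+_; _*_; _∸_; _≤_; _<_; z≤n; s≤s; parity)
open import Data.Nat.Properties
  using ( _≟_; *-suc; *-comm; *-zeroʳ; +-identityʳ; +-assoc; +-comm; *-distribˡ-+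
        ; +-commutativeSemigroup; *-cancelˡ-≡; suc-injective; ≡-irrelevant; even≢odd
        ; ≤-refl; ≤-trans; ≤-pred; <⇒≤; ≤-<-trans; n<1+n; n≤1+n; m≤n⇒m≤1+n; m≤m+n
        ; m≤n⇒m<n∨m≡n )
open import Data.Nat.Divisibility using (_∣_; divides)
open import Data.Parity.Base using (Parity; 0ℙ; 1ℙ; _⁻¹) renaming (_+_ to _⊕_)
open import Data.Parity.Properties
  using (+-homo-+; *-homo-*; *-idem; p+p≡0ℙ; ⁻¹-injective; +-0-abelianGroup)
  renaming (+-assoc to ⊕-assoc; +-identityʳ to ⊕-identityʳ)
open import Algebra.Properties.AbelianGroup +-0-abelianGroup using (xyx⁻¹≈y)
open import Algebra.Properties.CommutativeSemigroup +-commutativeSemigroup using (interchange)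
open import Data.Fin using (Fin)
open import Data.Fin.Properties using (+↔⊎; *↔×; 0↔⊥; 1↔⊤)
open import Data.Fin.Permutation using (↔⇒≡)
open import Data.List using (List; []; _∷_)
open import Data.List.Relation.Unary.Any using (Any; here; there; any?; satisfied)
import Data.List.Relation.Unary.Any as Any
open import Data.List.Membership.Propositional using (_∈_; find)
open import Data.Product using (Σ; ∃; _×_; _,_; proj₂)
open import Data.Product.Function.NonDependent.Propositional using (_×-↔_)
open import Data.Sum using (_⊎_; inj₁; inj₂)
open import Data.Sum.Function.Propositional using (_⊎-↔_)
open import Data.Unit using (⊤)
open import Data.Empty using (⊥)
open import Function using (_∘_; _$_; case_of_)
open import Function.Bundles using (_↔_; _⇔_; mk↔ₛ′; mk⇔; Equivalence)
open import Function.Properties.Inverse using (↔-refl; ↔-sym; ↔-trans)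
open import Function.Related.Propositional using (module EquationalReasoning)
open import Relation.Nullary using (¬_; yes; no; contradiction)
open import Relation.Binary.PropositionalEquality

data EvenOrOdd : ℕ → Set where
  even : ∀ k → EvenOrOdd (2 * k)
  odd  : ∀ k → EvenOrOdd (suc (2 * k))

even-or-odd : ∀ n → EvenOrOdd n
even-or-odd zero = even 0
even-or-odd (suc n) with even-or-odd n
... | even k = odd k
... | odd k  = subst EvenOrOdd (*-suc 2 k) (even (suc k))

parity-suc-2* : ∀ k → parity (suc (2 * k)) ≡ 1ℙ
parity-suc-2* k = trans (+-homo-+ 1 (2 * k)) (cong _⁻¹ (*-homo-* 2 k))

2∣⇔parity≡0ℙ : ∀ n → 2 ∣ n ⇔ parity n ≡ 0ℙ
2∣⇔parity≡0ℙ n = mk⇔ to from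
  where
  to : 2 ∣ n → parity n ≡ 0ℙ
  to (divides k refl) = trans (cong parity (*-comm k 2)) (*-homo-* 2 k)
  from : parity n ≡ 0ℙ → 2 ∣ n
  from p≡0 with even-or-odd n
  ... | even k = divides k (*-comm 2 k)
  ... | odd k  = contradiction (trans (sym (parity-suc-2* k)) p≡0) λ ()

-- Convolution of sequences

infixl 7 _⋆_

_⋆_ : (ℕ → ℕ) → (ℕ → ℕ) → ℕ → ℕ
(f ⋆ g) zero    = f 0 * g 0
(f ⋆ g) (suc n) = f 0 * g (suc n) + ((f ∘ suc) ⋆ g) n

shift : (ℕ → ℕ) → ℕ → ℕ
shift f zero    = 0
shift f (suc n) = f n

⋆-distribˡ-+ : ∀ f g h n → (f ⋆ (λ j → g j + h j)) n ≡ (f ⋆ g) n + (f ⋆ h) n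
⋆-distribˡ-+ f g h zero    = *-distribˡ-+ (f 0) (g 0) (h 0)
⋆-distribˡ-+ f g h (suc n) = begin
  f 0 * (g (suc n) + h (suc n)) + ((f ∘ suc) ⋆ (λ j → g j + h j)) n
    ≡⟨ cong₂ _+_ (*-distribˡ-+ (f 0) (g (suc n)) (h (suc n))) (⋆-distribˡ-+ (f ∘ suc) g h n) ⟩
  (f 0 * g (suc n) + f 0 * h (suc n)) + (((f ∘ suc) ⋆ g) n + ((f ∘ suc) ⋆ h) n)
    ≡⟨ interchange (f 0 * g (suc n)) _ _ _ ⟩
  (f ⋆ g) (suc n) + (f ⋆ h) (suc n) ∎
  where open ≡-Reasoning

⋆-split-last : ∀ f g n → (f ⋆ g) (suc n) ≡ (f ⋆ (g ∘ suc)) n + f (suc n) * g 0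
⋆-split-last f g zero    = refl
⋆-split-last f g (suc n) = begin
  f 0 * g (2 + n) + ((f ∘ suc) ⋆ g) (suc n)
    ≡⟨ cong (f 0 * g (2 + n) +_) (⋆-split-last (f ∘ suc) g n) ⟩
  f 0 * g (2 + n) + (((f ∘ suc) ⋆ (g ∘ suc)) n + f (2 + n) * g 0)
    ≡⟨ +-assoc (f 0 * g (2 + n)) _ _ ⟨
  (f ⋆ (g ∘ suc)) (suc n) + f (2 + n) * g 0 ∎
  where open ≡-Reasoning

⋆-shift : ∀ f g n → (f ⋆ shift g) (suc n) ≡ (f ⋆ g) n
⋆-shift f g n = begin
  (f ⋆ shift g) (suc n)      ≡⟨ ⋆-split-last f (shift g) n ⟩
  (f ⋆ g) n + f (suc n) * 0  ≡⟨ cong ((f ⋆ g) n +_) (*-zeroʳ (f (suc n))) ⟩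
  (f ⋆ g) n + 0              ≡⟨ +-identityʳ _ ⟩
  (f ⋆ g) n                  ∎
  where open ≡-Reasoning

-- The outermost terms f 0 * f (2 + n) and f (2 + n) * f 0 cancel modulo 2.
parity-⋆-self-peel : ∀ f n → parity ((f ⋆ f) (2 + n)) ≡ parity (((f ∘ suc) ⋆ (f ∘ suc)) n)
parity-⋆-self-peel f n = begin
  parity (a + ((f ∘ suc) ⋆ f) (suc n))  ≡⟨ cong (λ x → parity (a + x)) (⋆-split-last (f ∘ suc) f n) ⟩
  parity (a + (X + f (2 + n) * f 0))    ≡⟨ cong (λ b → parity (a + (X + b))) (*-comm (f (2 + n)) (f 0)) ⟩
  parity (a + (X + a))                  ≡⟨ cong parity (+-assoc a X a) ⟨
  parity (a + X + a)                    ≡⟨ +-homo-+ (a + X) a ⟩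
  parity (a + X) ⊕ parity a             ≡⟨ cong (_⊕ parity a) (+-homo-+ a X) ⟩
  parity a ⊕ parity X ⊕ parity a        ≡⟨ xyx⁻¹≈y (parity a) (parity X) ⟩
  parity X                              ∎
  where
  open ≡-Reasoning
  a = f 0 * f (2 + n)
  X = ((f ∘ suc) ⋆ (f ∘ suc)) n

parity-⋆-self-even : ∀ f k → parity ((f ⋆ f) (2 * k)) ≡ parity (f k)
parity-⋆-self-even f zero    = trans (*-homo-* (f 0) (f 0)) (*-idem (parity (f 0)))
parity-⋆-self-even f (suc k) = begin
  parity ((f ⋆ f) (2 * suc k))                 ≡⟨ cong (parity ∘ (f ⋆ f)) (*-suc 2 k) ⟩
  parity ((f ⋆ f) (2 + 2 * k))                 ≡⟨ parity-⋆-self-peel f (2 * k) ⟩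
  parity (((f ∘ suc) ⋆ (f ∘ suc)) (2 * k))     ≡⟨ parity-⋆-self-even (f ∘ suc) k ⟩
  parity (f (suc k))                           ∎
  where open ≡-Reasoning

parity-⋆-self-odd : ∀ f k → parity ((f ⋆ f) (suc (2 * k))) ≡ 0ℙ
parity-⋆-self-odd f zero    = begin
  parity (f 0 * f 1 + f 1 * f 0)           ≡⟨ cong (λ b → parity (f 0 * f 1 + b)) (*-comm (f 1) (f 0)) ⟩
  parity (f 0 * f 1 + f 0 * f 1)           ≡⟨ +-homo-+ (f 0 * f 1) (f 0 * f 1) ⟩
  parity (f 0 * f 1) ⊕ parity (f 0 * f 1)  ≡⟨ p+p≡0ℙ (parity (f 0 * f 1)) ⟩
  0ℙ                                       ∎
  where open ≡-Reasoning
parity-⋆-self-odd f (suc k) = begin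
  parity ((f ⋆ f) (suc (2 * suc k)))              ≡⟨ cong (parity ∘ (f ⋆ f) ∘ suc) (*-suc 2 k) ⟩
  parity ((f ⋆ f) (2 + suc (2 * k)))              ≡⟨ parity-⋆-self-peel f (suc (2 * k)) ⟩
  parity (((f ∘ suc) ⋆ (f ∘ suc)) (suc (2 * k)))  ≡⟨ parity-⋆-self-odd (f ∘ suc) k ⟩
  0ℙ                                              ∎
  where open ≡-Reasoning

parity-⋆-shift-even : ∀ f k → parity ((f ⋆ shift f) (2 * k)) ≡ 0ℙ
parity-⋆-shift-even f zero    = cong parity (*-zeroʳ (f 0))
parity-⋆-shift-even f (suc k) = begin
  parity ((f ⋆ shift f) (2 * suc k))      ≡⟨ cong (parity ∘ (f ⋆ shift f)) (*-suc 2 k) ⟩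
  parity ((f ⋆ shift f) (2 + 2 * k))      ≡⟨ cong parity (⋆-shift f f (suc (2 * k))) ⟩
  parity ((f ⋆ f) (suc (2 * k)))          ≡⟨ parity-⋆-self-odd f k ⟩
  0ℙ                                      ∎
  where open ≡-Reasoning

infixl 7 _⊛_

_⊛_ : (ℕ → Set) → (ℕ → Set) → ℕ → Set
(P ⊛ Q) n = Σ ℕ λ a → Σ ℕ λ b → a + b ≡ n × P a × Q b

module _ {P Q : ℕ → Set} where

  ⊛-zero : (P ⊛ Q) 0 ↔ (P 0 × Q 0)
  ⊛-zero = mk↔ₛ′ to from (λ _ → refl) from∘to
    where
    to : (P ⊛ Q) 0 → P 0 × Q 0
    to (zero , zero , refl , p , q) = p , q
    from : P 0 × Q 0 → (P ⊛ Q) 0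
    from (p , q) = 0 , 0 , refl , p , q
    from∘to : ∀ x → from (to x) ≡ x
    from∘to (zero , zero , refl , p , q) = refl

  ⊛-suc : ∀ n → (P ⊛ Q) (suc n) ↔ ((P 0 × Q (suc n)) ⊎ ((P ∘ suc) ⊛ Q) n)
  ⊛-suc n = mk↔ₛ′ to from to∘from from∘to
    where
    to : (P ⊛ Q) (suc n) → (P 0 × Q (suc n)) ⊎ ((P ∘ suc) ⊛ Q) n
    to (zero  , b , refl , p , q) = inj₁ (p , q)
    to (suc a , b , refl , p , q) = inj₂ (a , b , refl , p , q)
    from : (P 0 × Q (suc n)) ⊎ ((P ∘ suc) ⊛ Q) n → (P ⊛ Q) (suc n)
    from (inj₁ (p , q))                = 0 , suc n , refl , p , q
    from (inj₂ (a , b , refl , p , q)) = suc a , b , refl , p , q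
    to∘from : ∀ y → to (from y) ≡ y
    to∘from (inj₁ _)                      = refl
    to∘from (inj₂ (a , b , refl , p , q)) = refl
    from∘to : ∀ x → from (to x) ≡ x
    from∘to (zero  , b , refl , p , q) = refl
    from∘to (suc a , b , refl , p , q) = refl

⊛-↔ : ∀ {P Q : ℕ → Set} {p q : ℕ → ℕ} n →
      (∀ a → a ≤ n → P a ↔ Fin (p a)) → (∀ b → b ≤ n → Q b ↔ Fin (q b)) →
      (P ⊛ Q) n ↔ Fin ((p ⋆ q) n)
⊛-↔ {P} {Q} {p} {q} zero P↔ Q↔ = begin
  (P ⊛ Q) 0                ↔⟨ ⊛-zero ⟩
  (P 0 × Q 0)              ↔⟨ P↔ 0 z≤n ×-↔ Q↔ 0 z≤n ⟩
  (Fin (p 0) × Fin (q 0))  ↔⟨ *↔× {p 0} {q 0} ⟨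
  Fin (p 0 * q 0)          ∎
  where open EquationalReasoning
⊛-↔ {P} {Q} {p} {q} (suc n) P↔ Q↔ = begin
  (P ⊛ Q) (suc n)
    ↔⟨ ⊛-suc n ⟩
  ((P 0 × Q (suc n)) ⊎ ((P ∘ suc) ⊛ Q) n)
    ↔⟨ (P↔ 0 z≤n ×-↔ Q↔ (suc n) ≤-refl) ⊎-↔ ⊛-↔ n (λ a a≤n → P↔ (suc a) (s≤s a≤n))
                                                  (λ b b≤n → Q↔ b (m≤n⇒m≤1+n b≤n)) ⟩
  ((Fin (p 0) × Fin (q (suc n))) ⊎ Fin (((p ∘ suc) ⋆ q) n))
    ↔⟨ *↔× {p 0} {q (suc n)} ⊎-↔ ↔-refl ⟨
  (Fin (p 0 * q (suc n)) ⊎ Fin (((p ∘ suc) ⋆ q) n))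
    ↔⟨ +↔⊎ {p 0 * q (suc n)} ⟨
  Fin ((p ⋆ q) (suc n)) ∎
  where open EquationalReasoning

-- Counting trees and forests

Forest : ℕ → Set
Forest n = Σ (List PTree) λ ts → edgesF ts ≡ n × ValidF ts

Forest⁺ : ℕ → Set
Forest⁺ n = Σ PTree λ t → Σ (List PTree) λ ts → edgesF (t ∷ ts) ≡ n × ValidF (t ∷ ts)

trees-zero : RiordanTrees 0 ↔ ⊤
trees-zero = mk↔ₛ′ _ (λ _ → leaf) (λ _ → refl) from∘to
  where
  leaf : RiordanTrees 0
  leaf = node [] , refl , node (inj₁ refl) []
  from∘to : ∀ t → leaf ≡ t
  from∘to (node [] , refl , node (inj₁ refl) []) = refl
  from∘to (node [] , refl , node (inj₂ ()) [])
  from∘to (node (_ ∷ _) , () , _)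

forests-zero : Forest 0 ↔ ⊤
forests-zero = mk↔ₛ′ _ (λ _ → [] , refl , []) (λ _ → refl) from∘to
  where
  from∘to : ∀ ts → ([] , refl , []) ≡ ts
  from∘to ([] , refl , [])  = refl
  from∘to (_ ∷ _ , () , _)

forests⁺-zero : Forest⁺ 0 ↔ ⊥
forests⁺-zero = mk↔ₛ′ (λ { (_ , _ , () , _) }) (λ ()) (λ ()) (λ { (_ , _ , () , _) })

trees-suc : ∀ m → RiordanTrees (suc m) ↔ (RiordanTrees ⊛ Forest⁺) m
trees-suc m = mk↔ₛ′ to from to∘from from∘to
  where
  to : RiordanTrees (suc m) → (RiordanTrees ⊛ Forest⁺) m
  to (node (t ∷ u ∷ us) , refl , node _ (v ∷ vs)) =
    edges t , edgesF (u ∷ us) , refl , (t , refl , v) , (u , us , refl , vs)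
  to (node [] , () , _)
  to (node (_ ∷ []) , _ , node (inj₁ ()) _)
  to (node (_ ∷ []) , _ , node (inj₂ (s≤s ())) _)
  from : (RiordanTrees ⊛ Forest⁺) m → RiordanTrees (suc m)
  from (_ , _ , refl , (t , refl , v) , (u , us , refl , vs)) =
    node (t ∷ u ∷ us) , refl , node (inj₂ (s≤s (s≤s z≤n))) (v ∷ vs)
  to∘from : ∀ x → to (from x) ≡ x
  to∘from (_ , _ , refl , (t , refl , v) , (u , us , refl , vs)) = refl
  from∘to : ∀ t → from (to t) ≡ t
  from∘to (node (t ∷ u ∷ us) , refl , node (inj₂ (s≤s (s≤s z≤n))) (v ∷ vs)) = refl
  from∘to (node (_ ∷ _ ∷ _) , _ , node (inj₁ ()) _)
  from∘to (node [] , () , _)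
  from∘to (node (_ ∷ []) , _ , node (inj₁ ()) _)
  from∘to (node (_ ∷ []) , _ , node (inj₂ (s≤s ())) _)

forests-suc : ∀ m → Forest (suc m) ↔ (RiordanTrees ⊛ Forest) m
forests-suc m = mk↔ₛ′ to from to∘from from∘to
  where
  to : Forest (suc m) → (RiordanTrees ⊛ Forest) m
  to (t ∷ ts , refl , v ∷ vs) = edges t , edgesF ts , refl , (t , refl , v) , (ts , refl , vs)
  from : (RiordanTrees ⊛ Forest) m → Forest (suc m)
  from (_ , _ , refl , (t , refl , v) , (ts , refl , vs)) = t ∷ ts , refl , v ∷ vs
  to∘from : ∀ x → to (from x) ≡ x
  to∘from (_ , _ , refl , (t , refl , v) , (ts , refl , vs)) = refl
  from∘to : ∀ ts → from (to ts) ≡ ts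
  from∘to (t ∷ ts , refl , v ∷ vs) = refl

forests⁺-suc : ∀ m → Forest⁺ (suc m) ↔ Forest (suc m)
forests⁺-suc m = mk↔ₛ′ to from to∘from (λ _ → refl)
  where
  to : Forest⁺ (suc m) → Forest (suc m)
  to (t , ts , e , vs) = t ∷ ts , e , vs
  from : Forest (suc m) → Forest⁺ (suc m)
  from (t ∷ ts , e , vs) = t , ts , e , vs
  to∘from : ∀ ts → to (from ts) ≡ ts
  to∘from (_ ∷ _ , _ , _) = refl

forests-split : ∀ m → Forest (suc m) ↔ (RiordanTrees (suc m) ⊎ RiordanTrees m)
forests-split m = mk↔ₛ′ to from to∘from from∘to
  where
  to : Forest (suc m) → RiordanTrees (suc m) ⊎ RiordanTrees m
  to (t ∷ [] , e , v ∷ []) = inj₂ (t , trans (sym (+-identityʳ (edges t))) (suc-injective e) , v)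
  to (t ∷ u ∷ us , e , vs) = inj₁ (node (t ∷ u ∷ us) , e , node (inj₂ (s≤s (s≤s z≤n))) vs)
  from : RiordanTrees (suc m) ⊎ RiordanTrees m → Forest (suc m)
  from (inj₁ (node (t ∷ u ∷ us) , e , node _ vs)) = t ∷ u ∷ us , e , vs
  from (inj₁ (node [] , () , _))
  from (inj₁ (node (_ ∷ []) , _ , node (inj₁ ()) _))
  from (inj₁ (node (_ ∷ []) , _ , node (inj₂ (s≤s ())) _))
  from (inj₂ (t , e , v)) = t ∷ [] , cong suc (trans (+-identityʳ (edges t)) e) , v ∷ []
  to∘from : ∀ x → to (from x) ≡ x
  to∘from (inj₁ (node (_ ∷ _ ∷ _) , _ , node (inj₂ (s≤s (s≤s z≤n))) _)) = refl
  to∘from (inj₁ (node (_ ∷ _ ∷ _) , _ , node (inj₁ ()) _))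
  to∘from (inj₁ (node [] , () , _))
  to∘from (inj₁ (node (_ ∷ []) , _ , node (inj₁ ()) _))
  to∘from (inj₁ (node (_ ∷ []) , _ , node (inj₂ (s≤s ())) _))
  to∘from (inj₂ (t , e , v)) = cong (λ e → inj₂ (t , e , v)) (≡-irrelevant _ _)
  from∘to : ∀ ts → from (to ts) ≡ ts
  from∘to (t ∷ [] , e , v ∷ []) = cong (λ e → t ∷ [] , e , v ∷ []) (≡-irrelevant _ _)
  from∘to (_ ∷ _ ∷ _ , _ , _) = refl
  from∘to ([] , () , _)

forests-split-↔ : ∀ {p : ℕ → ℕ} m → (∀ a → a ≤ suc m → RiordanTrees a ↔ Fin (p a)) →
                  Forest (suc m) ↔ Fin (p (suc m) + p m)
forests-split-↔ {p} m trees↔ = begin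
  Forest (suc m)                                ↔⟨ forests-split m ⟩
  (RiordanTrees (suc m) ⊎ RiordanTrees m)       ↔⟨ trees↔ (suc m) ≤-refl ⊎-↔ trees↔ m (n≤1+n m) ⟩
  (Fin (p (suc m)) ⊎ Fin (p m))                 ↔⟨ +↔⊎ {p (suc m)} ⟨
  Fin (p (suc m) + p m)                         ∎
  where open EquationalReasoning

forests⁺-count : (ℕ → ℕ) → ℕ → ℕ
forests⁺-count p zero    = 0
forests⁺-count p (suc b) = p (suc b) + p b

forests⁺-↔ : ∀ {p : ℕ → ℕ} b → (∀ a → a ≤ b → RiordanTrees a ↔ Fin (p a)) →
             Forest⁺ b ↔ Fin (forests⁺-count p b)
forests⁺-↔ zero    _      = ↔-trans forests⁺-zero (↔-sym 0↔⊥)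
forests⁺-↔ (suc b) trees↔ = ↔-trans (forests⁺-suc b) (forests-split-↔ b trees↔)

-- The fuel f only makes the recursion structural: by trees-↔[_] it is irrelevant once f ≥ n.
γ[_] : ℕ → ℕ → ℕ
γ[ _ ]     zero    = 1
γ[ zero ]  (suc n) = 0
γ[ suc f ] (suc n) = (γ[ f ] ⋆ forests⁺-count γ[ f ]) n

trees-↔[_] : ∀ f {n} → n ≤ f → RiordanTrees n ↔ Fin (γ[ f ] n)
trees-↔[ f ]     {zero}  _         = ↔-trans trees-zero (↔-sym 1↔⊤)
trees-↔[ suc f ] {suc n} (s≤s n≤f) =
  ↔-trans (trees-suc n)
    (⊛-↔ n (λ a a≤n → trees-↔[ f ] (≤-trans a≤n n≤f))
           (λ b b≤n → forests⁺-↔ b (λ a a≤b → trees-↔[ f ] (≤-trans a≤b (≤-trans b≤n n≤f)))))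

γ : ℕ → ℕ
γ n = γ[ n ] n

trees-↔ : ∀ n → RiordanTrees n ↔ Fin (γ n)
trees-↔ n = trees-↔[ n ] ≤-refl

forests-↔ : ∀ n → Forest n ↔ Fin (γ n + shift γ n)
forests-↔ zero    = ↔-trans forests-zero (↔-sym 1↔⊤)
forests-↔ (suc m) = forests-split-↔ m (λ a _ → trees-↔ a)

γ-recurrence : ∀ m → γ (suc m) + γ m ≡ (γ ⋆ λ b → γ b + shift γ b) m
γ-recurrence m = ↔⇒≡ (begin
  Fin (γ (suc m) + γ m)                  ↔⟨ forests-split-↔ m (λ a _ → trees-↔ a) ⟨
  Forest (suc m)                         ↔⟨ forests-suc m ⟩
  (RiordanTrees ⊛ Forest) m              ↔⟨ ⊛-↔ m (λ a _ → trees-↔ a) (λ b _ → forests-↔ b) ⟩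
  Fin ((γ ⋆ λ b → γ b + shift γ b) m)    ∎)
  where open EquationalReasoning

-- Parity of the Riordan numbers

p⊕q≡r⇒p≡q⊕r : ∀ p q {r} → p ⊕ q ≡ r → p ≡ q ⊕ r
p⊕q≡r⇒p≡q⊕r 0ℙ 0ℙ refl = refl
p⊕q≡r⇒p≡q⊕r 0ℙ 1ℙ refl = refl
p⊕q≡r⇒p≡q⊕r 1ℙ 0ℙ refl = refl
p⊕q≡r⇒p≡q⊕r 1ℙ 1ℙ refl = refl

parity-γ-step : ∀ m → parity (γ (suc m)) ≡ parity (γ m) ⊕ (parity ((γ ⋆ γ) m) ⊕ parity ((γ ⋆ shift γ) m))
parity-γ-step m = p⊕q≡r⇒p≡q⊕r (parity (γ (suc m))) (parity (γ m)) (begin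
  parity (γ (suc m)) ⊕ parity (γ m)              ≡⟨ +-homo-+ (γ (suc m)) (γ m) ⟨
  parity (γ (suc m) + γ m)                       ≡⟨ cong parity (γ-recurrence m) ⟩
  parity ((γ ⋆ λ b → γ b + shift γ b) m)         ≡⟨ cong parity (⋆-distribˡ-+ γ γ (shift γ) m) ⟩
  parity ((γ ⋆ γ) m + (γ ⋆ shift γ) m)           ≡⟨ +-homo-+ ((γ ⋆ γ) m) _ ⟩
  parity ((γ ⋆ γ) m) ⊕ parity ((γ ⋆ shift γ) m)  ∎)
  where open ≡-Reasoning

parity-γ-odd-step : ∀ k → parity (γ (suc (2 * k))) ≡ parity (γ (2 * k)) ⊕ parity (γ k)
parity-γ-odd-step k = begin
  parity (γ (suc (2 * k)))
    ≡⟨ parity-γ-step (2 * k) ⟩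
  parity (γ (2 * k)) ⊕ (parity ((γ ⋆ γ) (2 * k)) ⊕ parity ((γ ⋆ shift γ) (2 * k)))
    ≡⟨ cong (parity (γ (2 * k)) ⊕_) (cong₂ _⊕_ (parity-⋆-self-even γ k) (parity-⋆-shift-even γ k)) ⟩
  parity (γ (2 * k)) ⊕ (parity (γ k) ⊕ 0ℙ)
    ≡⟨ cong (parity (γ (2 * k)) ⊕_) (⊕-identityʳ (parity (γ k))) ⟩
  parity (γ (2 * k)) ⊕ parity (γ k)
    ∎
  where open ≡-Reasoning

parity-γ-even-step : ∀ k → parity (γ (2 + 2 * k)) ≡ parity (γ (suc (2 * k))) ⊕ parity (γ k)
parity-γ-even-step k = begin
  parity (γ (2 + 2 * k))
    ≡⟨ parity-γ-step (suc (2 * k)) ⟩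
  parity (γ (suc (2 * k))) ⊕ (parity ((γ ⋆ γ) (suc (2 * k))) ⊕ parity ((γ ⋆ shift γ) (suc (2 * k))))
    ≡⟨ cong (parity (γ (suc (2 * k))) ⊕_) (cong₂ _⊕_ (parity-⋆-self-odd γ k) shifted) ⟩
  parity (γ (suc (2 * k))) ⊕ (0ℙ ⊕ parity (γ k))
    ∎
  where
  open ≡-Reasoning
  shifted : parity ((γ ⋆ shift γ) (suc (2 * k))) ≡ parity (γ k)
  shifted = trans (cong parity (⋆-shift γ γ (2 * k))) (parity-⋆-self-even γ k)

parity-γ-even : ∀ k → parity (γ (2 * k)) ≡ 1ℙ
parity-γ-even zero    = refl
parity-γ-even (suc k) = begin
  parity (γ (2 * suc k))                         ≡⟨ cong (parity ∘ γ) (*-suc 2 k) ⟩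
  parity (γ (2 + 2 * k))                         ≡⟨ parity-γ-even-step k ⟩
  parity (γ (suc (2 * k))) ⊕ p                   ≡⟨ cong (_⊕ p) (parity-γ-odd-step k) ⟩
  parity (γ (2 * k)) ⊕ p ⊕ p                     ≡⟨ ⊕-assoc (parity (γ (2 * k))) p p ⟩
  parity (γ (2 * k)) ⊕ (p ⊕ p)                   ≡⟨ cong (parity (γ (2 * k)) ⊕_) (p+p≡0ℙ p) ⟩
  parity (γ (2 * k)) ⊕ 0ℙ                        ≡⟨ ⊕-identityʳ _ ⟩
  parity (γ (2 * k))                             ≡⟨ parity-γ-even k ⟩
  1ℙ                                             ∎
  where
  open ≡-Reasoning
  p = parity (γ k)

parity-γ-odd : ∀ k → parity (γ (suc (2 * k))) ≡ parity (γ k) ⁻¹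
parity-γ-odd k = trans (parity-γ-odd-step k) (cong (_⊕ parity (γ k)) (parity-γ-even k))

parity-γ≡0ℙ⇔ : ∀ n → parity (γ n) ≡ 0ℙ ⇔ ∃ λ y → n ≡ 2 * y ∸ 1 × parity (shift γ y) ≡ 1ℙ
parity-γ≡0ℙ⇔ n = mk⇔ to from
  where
  to : parity (γ n) ≡ 0ℙ → ∃ λ y → n ≡ 2 * y ∸ 1 × parity (shift γ y) ≡ 1ℙ
  to p≡0 with even-or-odd n
  ... | even k = contradiction (trans (sym (parity-γ-even k)) p≡0) λ ()
  ... | odd i  = suc i , sym (cong (_∸ 1) (*-suc 2 i)) , ⁻¹-injective (trans (sym (parity-γ-odd i)) p≡0)
  from : (∃ λ y → n ≡ 2 * y ∸ 1 × parity (shift γ y) ≡ 1ℙ) → parity (γ n) ≡ 0ℙ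
  from (zero  , _    , ())
  from (suc i , refl , p≡1) =
    trans (cong (λ m → parity (γ (m ∸ 1))) (*-suc 2 i)) (trans (parity-γ-odd i) (cong _⁻¹ p≡1))

-- The sequence c

HalfSucIn : ℕ → List ℕ → Set
HalfSucIn x l = Any (λ y → 2 * y ≡ x + 1) l

cNext-∈ : ∀ {x l} → HalfSucIn x l → cNext x l ≡ suc (suc x)
cNext-∈ {x} {l} h with any? (λ y → 2 * y ≟ x + 1) l
... | yes _ = +-comm x 2
... | no ¬h = contradiction h ¬h

cNext-∉ : ∀ {x l} → ¬ HalfSucIn x l → cNext x l ≡ suc x
cNext-∉ {x} {l} ¬h with any? (λ y → 2 * y ≟ x + 1) l
... | yes h = contradiction h ¬h
... | no _  = +-comm x 1

x<cNext : ∀ x l → x < cNext x l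
x<cNext x l with any? (λ y → 2 * y ≟ x + 1) l
... | yes _ = subst (x <_) (sym (+-comm x 2)) (n≤1+n (suc x))
... | no _  = subst (x <_) (sym (+-comm x 1)) (n<1+n x)

prefix : ℕ → List ℕ
prefix n = proj₂ (cPrefix n)

n<c : ∀ n → n < c n
n<c zero    = s≤s z≤n
n<c (suc n) = ≤-<-trans (n<c n) (x<cNext (c n) (prefix n))

c∈prefix : ∀ n → c n ∈ prefix n
c∈prefix zero    = here refl
c∈prefix (suc n) = here refl

∈prefix⇒term : ∀ n {y} → y ∈ prefix n → ∃ λ k → c k ≡ y
∈prefix⇒term zero    (here refl)  = 0 , refl
∈prefix⇒term (suc n) (here refl)  = suc n , refl
∈prefix⇒term (suc n) (there y∈l) = ∈prefix⇒term n y∈l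

2*suc≡suc[2*]+1 : ∀ i → 2 * suc i ≡ suc (2 * i) + 1
2*suc≡suc[2*]+1 i = trans (*-suc 2 i) (+-comm 1 (suc (2 * i)))

module Enumeration
  (s : ℕ → Parity)
  (s-zero : s 0 ≡ 0ℙ)
  (s-odd  : ∀ k → s (suc (2 * k)) ≡ 1ℙ)
  (s-even : ∀ k → s (2 + 2 * k) ≡ s (suc k) ⁻¹)
  where

  record Enumerates (x : ℕ) (l : List ℕ) : Set where
    field
      sound    : ∀ {y} → y ∈ l → s y ≡ 1ℙ
      complete : ∀ {y} → y ≤ x → s y ≡ 1ℙ → y ∈ l
  open Enumerates

  enumerates-skip : ∀ {x l} → Enumerates x l → s (suc x) ≡ 0ℙ → Enumerates (suc x) l
  enumerates-skip {x} {l} e s[1+x]≡0 = record { sound = sound e ; complete = complete′ }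
    where
    complete′ : ∀ {y} → y ≤ suc x → s y ≡ 1ℙ → y ∈ l
    complete′ y≤1+x sy≡1 with m≤n⇒m<n∨m≡n y≤1+x
    ... | inj₁ y<1+x = complete e (≤-pred y<1+x) sy≡1
    ... | inj₂ refl  = contradiction (trans (sym sy≡1) s[1+x]≡0) λ ()

  enumerates-push : ∀ {x l} → Enumerates x l → s (suc x) ≡ 1ℙ → Enumerates (suc x) (suc x ∷ l)
  enumerates-push {x} {l} e s[1+x]≡1 = record { sound = sound′ ; complete = complete′ }
    where
    sound′ : ∀ {y} → y ∈ suc x ∷ l → s y ≡ 1ℙ
    sound′ (here refl) = s[1+x]≡1
    sound′ (there y∈l) = sound e y∈l
    complete′ : ∀ {y} → y ≤ suc x → s y ≡ 1ℙ → y ∈ suc x ∷ l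
    complete′ y≤1+x sy≡1 with m≤n⇒m<n∨m≡n y≤1+x
    ... | inj₁ y<1+x = there (complete e (≤-pred y<1+x) sy≡1)
    ... | inj₂ refl  = here refl

  head-≡ : ∀ {x z l} → x ≡ z → Enumerates z (z ∷ l) → Enumerates x (x ∷ l)
  head-≡ refl e = e

  enumerates-cNext : ∀ {x l} → Enumerates x l → Enumerates (cNext x l) (cNext x l ∷ l)
  enumerates-cNext {x} {l} e with even-or-odd x
  ... | even k = head-≡ (cNext-∉ no-half) (enumerates-push e (s-odd k))
    where
    no-half : ¬ HalfSucIn (2 * k) l
    no-half h with satisfied h
    ... | y , 2y≡2k+1 = even≢odd y k (trans 2y≡2k+1 (+-comm (2 * k) 1))
  ... | odd i with s (suc i) in s[1+i]
  ...   | 1ℙ = head-≡ (cNext-∈ half) $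
          enumerates-push (enumerates-skip e (trans (s-even i) (cong _⁻¹ s[1+i])))
                          (subst (λ n → s (suc n) ≡ 1ℙ) (*-suc 2 i) (s-odd (suc i)))
    where
    half : HalfSucIn (suc (2 * i)) l
    half = Any.map (λ { refl → 2*suc≡suc[2*]+1 i })
                   (complete e (s≤s (m≤m+n i (i + 0))) s[1+i])
  ...   | 0ℙ = head-≡ (cNext-∉ no-half) $ enumerates-push e (trans (s-even i) (cong _⁻¹ s[1+i]))
    where
    no-half : ¬ HalfSucIn (suc (2 * i)) l
    no-half h with find h
    ... | y , y∈l , 2y≡2i+2 with *-cancelˡ-≡ y (suc i) 2 (trans 2y≡2i+2 (sym (2*suc≡suc[2*]+1 i)))
    ...   | refl = contradiction (trans (sym s[1+i]) (sound e y∈l)) λ ()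

  enumerates-prefix : ∀ n → Enumerates (c n) (prefix n)
  enumerates-prefix zero    = record { sound = λ { (here refl) → s-odd 0 } ; complete = complete′ }
    where
    complete′ : ∀ {y} → y ≤ 1 → s y ≡ 1ℙ → y ∈ 1 ∷ []
    complete′ {zero}  _ s0≡1 = contradiction (trans (sym s-zero) s0≡1) λ ()
    complete′ {suc zero} _ _ = here refl
    complete′ {suc (suc _)} (s≤s ()) _
  enumerates-prefix (suc n) = enumerates-cNext (enumerates-prefix n)

  terms-of-c : ∀ y → (∃ λ k → c k ≡ y) ⇔ s y ≡ 1ℙ
  terms-of-c y = mk⇔
    (λ { (k , refl) → sound (enumerates-prefix k) (c∈prefix k) })
    (λ sy≡1 → ∈prefix⇒term y (complete (enumerates-prefix y) (<⇒≤ (n<c y)) sy≡1))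

  ∃-term⇔ : (P : ℕ → Set) → (∃ λ y → P y × s y ≡ 1ℙ) ⇔ ∃ λ k → P (c k)
  ∃-term⇔ P = mk⇔
    (λ { (y , py , sy≡1) → case Equivalence.from (terms-of-c y) sy≡1 of λ { (k , refl) → k , py } })
    (λ { (k , pck) → c k , pck , Equivalence.to (terms-of-c (c k)) (k , refl) })

open Enumeration (λ y → parity (shift γ y)) refl parity-γ-even parity-γ-odd

corollary3p3 : (n γn : ℕ) → Fin γn ↔ RiordanTrees n →
    ((2 ∣ γn) ⇔ ∃ λ k → n ≡ 2 * c k ∸ 1)
corollary3p3 n γn Fin↔trees = begin
  2 ∣ γn                                              ≡⟨ cong (2 ∣_) (↔⇒≡ (↔-trans Fin↔trees (trees-↔ n))) ⟩
  2 ∣ γ n                                             ∼⟨ 2∣⇔parity≡0ℙ (γ n) ⟩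
  parity (γ n) ≡ 0ℙ                                   ∼⟨ parity-γ≡0ℙ⇔ n ⟩
  (∃ λ y → n ≡ 2 * y ∸ 1 × parity (shift γ y) ≡ 1ℙ)   ∼⟨ ∃-term⇔ (λ y → n ≡ 2 * y ∸ 1) ⟩
  (∃ λ k → n ≡ 2 * c k ∸ 1)                           ∎
  where open EquationalReasoning
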